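{- Let $d=\gcd(m,n)$, let $\mathbf{p}$ be an $(m,n)$-parking function, and let $\mathbf{x}\in V^m$ be a fixed point of $\mathbf{p}$ lying in the interior of some alcove. Then the coordinates of $\mathbf{x}$ can be partitioned into sets $P_0,\dots,P_{d-1}$, each of size $m/d$, such that for all $0\le i\le d-1$ and all $a\ne b$ in $P_i$: (1) $a-b\in d\mathbb{Z}$ and (2) $a-b\notin m\mathbb{Z}$. Furthermore, for $i\ne j$, $a\in P_i$ and $b\in P_j$, one has $a-b\notin d\mathbb{Z}$.
   Context: $[m]=\{0,\dots,m-1\}$, $V^m=\{\mathbf{x}\in\mathbb{R}^m:\sum x_i=0,\ x_0\le\dots\le x_{m-1}\}$. A letter $i\in[m]$ acts on $\mathbf{x}\in V^m$ by adding $m$ to $x_i$, subtracting $1$ from every coordinate, and sorting increasingly; a word $p_{n-1}\dots p_0$ acts from right to left. An $(m,n)$-parking function is $\mathbf{p}=p_{n-1}\dots p_0\in[m]^n$ with $\#\{j:p_j<i\}\ge in/m$ for $1\le i\le m$. Alcoves are closures of connected components of the complement of the arrangement $\{x_i-x_j=km:0\le i<j\le m-1,k\in\mathbb{Z}\}$ in $\{\sum x_i=0\}$. -}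

module Defs where

open import Level using (0ℓ)
open import Data.Nat as ℕ using (ℕ; zero; suc)
open import Data.Integer as ℤ using (ℤ; +_; -[1+_])
open import Data.Fin as Fin using (Fin; toℕ)
open import Data.Fin.Permutation using (Permutation′; _⟨$⟩ʳ_)
open import Data.Vec as Vec using (Vec; count; allFin)
open import Data.List using (List; []; _∷_)
open import Data.Product using (Σ; ∃; _×_; _,_)
open import Relation.Binary.PropositionalEquality using (_≡_; _≢_)
open import Relation.Binary.Structures using (IsTotalOrder)
open import Algebra.Structures using (IsCommutativeRing)
open import Relation.Nullary using (¬_)

-- The real numbers, axiomatised as a complete ordered field
-- (any two models are isomorphic, so quantifying over all models is
-- the same as speaking about ℝ).
record CompleteOrderedField : Set₁ where
  infixl 6 _+_ _-_
  infixl 7 _*_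
  infix 4 _≤_
  field
    Carrier : Set
    _+_ _*_ : Carrier → Carrier → Carrier
    -_ : Carrier → Carrier
    0# 1# : Carrier
    _≤_ : Carrier → Carrier → Set
    isCommutativeRing : IsCommutativeRing _≡_ _+_ _*_ -_ 0# 1#
    0≢1 : 0# ≢ 1#
    inverse : ∀ x → x ≢ 0# → ∃ λ y → x * y ≡ 1#
    isTotalOrder : IsTotalOrder _≡_ _≤_
    +-mono-≤ : ∀ {x y} z → x ≤ y → x + z ≤ y + z
    *-nonneg : ∀ {x y} → 0# ≤ x → 0# ≤ y → 0# ≤ x * y
    complete : (S : Carrier → Set) → ∃ S →
               (∃ λ b → ∀ x → S x → x ≤ b) →
               ∃ λ s → (∀ x → S x → x ≤ s) × (∀ b → (∀ x → S x → x ≤ b) → s ≤ b)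

  _-_ : Carrier → Carrier → Carrier
  x - y = x + (- y)

  fromℕ : ℕ → Carrier
  fromℕ zero = 0#
  fromℕ (suc k) = 1# + fromℕ k

  fromℤ : ℤ → Carrier
  fromℤ (+ k) = fromℕ k
  fromℤ -[1+ k ] = - fromℕ (suc k)

  sumF : ∀ {m} → (Fin m → Carrier) → Carrier
  sumF {zero} x = 0#
  sumF {suc m} x = x Fin.zero + sumF (λ i → x (Fin.suc i))

  _∈_ℤ : Carrier → ℕ → Set
  a ∈ k ℤ = ∃ λ (t : ℤ) → a ≡ fromℤ (ℤ.+ k ℤ.* t)

  Sorted : ∀ {m} → (Fin m → Carrier) → Set
  Sorted x = ∀ i j → i Fin.≤ j → x i ≤ x j

  InV : ∀ m → (Fin m → Carrier) → Set
  InV m x = sumF x ≡ 0# × Sorted x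

  -- action of a letter i ∈ [m]: add m to x_i, subtract 1 everywhere, sort.
  -- Stated relationally: y is the (unique) sorted rearrangement of the shifted vector.
  shift : ∀ {m} → Fin m → (Fin m → Carrier) → (Fin m → Carrier)
  shift {m} i x k with i Fin.≟ k
  ... | Relation.Nullary.yes _ = x k + fromℕ m - 1#
  ... | Relation.Nullary.no  _ = x k - 1#

  LetterAct : ∀ {m} → Fin m → (Fin m → Carrier) → (Fin m → Carrier) → Set
  LetterAct {m} i x y =
    Sorted y × ∃ λ (π : Permutation′ m) → ∀ k → y k ≡ shift i x (π ⟨$⟩ʳ k)

  -- action of a list of letters, the head acting first
  ListAct : ∀ {m} → List (Fin m) → (Fin m → Carrier) → (Fin m → Carrier) → Set
  ListAct [] x y = ∀ k → x k ≡ y k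
  ListAct (i ∷ w) x y = ∃ λ z → LetterAct i x z × ListAct w z y

  -- a word p = p_{n-1} … p_0 is stored as a vector with entry j equal to p_j;
  -- it acts right to left, i.e. p_0 first.
  WordAct : ∀ {m n} → Vec (Fin m) n → (Fin m → Carrier) → (Fin m → Carrier) → Set
  WordAct p = ListAct (Vec.toList p)

  FixedPoint : ∀ {m n} → Vec (Fin m) n → (Fin m → Carrier) → Set
  FixedPoint p x = WordAct p x x

  -- x lies on no hyperplane x_i - x_j = km (i < j, k ∈ ℤ), i.e. in the
  -- interior of some alcove
  InAlcoveInterior : ∀ m → (Fin m → Carrier) → Set
  InAlcoveInterior m x = ∀ i j → i Fin.< j → ¬ ((x i - x j) ∈ m ℤ)

IsParking : ∀ m n → Vec (Fin m) n → Set
IsParking m n p =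
  ∀ i → 1 ℕ.≤ i → i ℕ.≤ m →
    i ℕ.* n ℕ.≤ count (λ a → toℕ a ℕ.<? i) p ℕ.* m

classSize : ∀ {m d} → (Fin m → Fin d) → Fin d → ℕ
classSize {m} c i = count (λ k → c k Fin.≟ i) (allFin m)

{-# OPTIONS --safe #-}
module Submission where

-- Each letter moves every coordinate by -1 or by m - 1 before sorting, so following the
-- positions through the word shows that a fixed point x comes with a map ρ on positions
-- such that x (ρ a) ≡ n + x a (mod m).  Inside an alcove no two coordinates are congruent
-- mod m, so a position is determined by its coordinate mod m.  Hence
-- x (ρʲ a) ≡ j n + x a (mod m) shows that ρʲ a = a iff m ∣ j n iff q ∣ j, where
-- q = m / d, so every ρ-orbit has exactly q elements; and since the multiples of n modulo m
-- are exactly the multiples of d, a and b lie in the same orbit iff x a ≡ x b (mod d).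
-- The d orbits are the classes P_i.

open import Defs
open import Data.Nat as ℕ using (ℕ; _≤_)
open import Data.Nat.GCD using (gcd)
open import Data.Fin using (Fin)
open import Data.Vec using (Vec)
open import Data.Product using (Σ; _×_)
open import Relation.Binary.PropositionalEquality using (_≡_; _≢_)
open import Relation.Nullary using (¬_)

open import Level using (0ℓ)
open import Function.Base using (id; _∘_)
open import Function.Bundles using (_⇔_; mk⇔; Equivalence)
open import Function.Properties.Equivalence using () renaming (sym to ⇔-sym; trans to ⇔-trans)
open import Data.Empty using (⊥-elim)
open import Data.Sum using (inj₁; inj₂)
open import Data.Bool using (true; false)
open import Data.Product using (∃; _,_; proj₁; proj₂)
open import Data.Nat using (zero; suc; _∸_; _<_; NonZero; ≢-nonZero; ≢-nonZero⁻¹; >-nonZero)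
open import Data.Nat.Properties
  using (+-suc; +-cancelˡ-≡; m+n≡0⇒m≡0; *-comm; *-assoc; <⇒≢; <⇒≤; <⇒≱; ≤-<-trans; n<1+n;
         m<n⇒m<1+n; m<1+n⇒m<n∨m≡n; m∸n≤m; m∸n+n≡m; m<n⇒0<n∸m)
open import Data.Nat.Divisibility using (_∣_; divides; ∣-refl; ∣⇒≤; *-cancelʳ-∣; ∣n⇒∣m*n)
open import Data.Nat.DivMod using (_/_; m/n*n≡m)
open import Data.Nat.GCD using (gcd[m,n]∣m; gcd[m,n]∣n; gcd[m,n]≢0; m/gcd[m,n]≢0; gcd-GCD; module Bézout)
open import Data.Nat.Coprimality using (coprime-/gcd; coprime-divisor)
open import Data.Integer as ℤ using (ℤ; +_; -[1+_]; _⊖_; 0ℤ)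
open import Data.Integer.Properties as ℤ using ([1+m]⊖[1+n]≡m⊖n; i-j≡0⇒i≡j; neg-distribʳ-*; pos-*; pos-+; abs-*)
import Data.Integer.Divisibility.Signed as ℤ∣
open ℤ∣ using (divides; ∣ᵤ⇒∣) renaming (_∣_ to _∣ℤ_)
open import Data.Integer.DivMod using (_%ℕ_; _/ℕ_; n%ℕd<d; a≡a%ℕn+[a/ℕn]*n)
open import Data.Integer.Tactic.RingSolver using (solve-∀)
open import Data.Fin as Fin using (toℕ; fromℕ<)
open import Data.Fin.Properties using (toℕ<n; toℕ-fromℕ<; toℕ-injective; any?; <-cmp)
open import Data.Fin.Permutation using (_⟨$⟩ʳ_)
open import Data.List as List using (List; []; _∷_; length; filter)
open import Data.List.Properties using (length-tabulate; filter-≐)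
import Data.List.Membership.Propositional as Membership
open import Data.List.Membership.Propositional.Properties
  using (∈-filter⁺; ∈-filter⁻; ∈-tabulate⁺; ∈-tabulate⁻; ∈-allFin)
open import Data.List.Membership.Propositional.Properties.WithK using (unique∧set⇒bag)
open import Data.List.Relation.Unary.Any using (here)
open import Data.List.Relation.Unary.Unique.Propositional using (Unique)
open import Data.List.Relation.Unary.Unique.Propositional.Properties using (filter⁺; tabulate⁺; allFin⁺)
open import Data.List.Relation.Binary.BagAndSetEquality using (∼bag⇒↭)
open import Data.List.Relation.Binary.Permutation.Propositional.Properties using (↭-length)
import Data.Vec as Vec
open import Data.Vec.Properties using (length-toList)
open import Relation.Binary.PropositionalEquality
  using (refl; sym; trans; cong; cong₂; cong-app; subst; subst₂; module ≡-Reasoning)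
open import Relation.Binary.Bundles using (Setoid)
open import Relation.Binary.Structures using (IsEquivalence; IsTotalOrder)
open import Relation.Binary.Definitions using (Decidable; tri<; tri≈; tri>)
open import Relation.Binary.Core using (Rel)
import Relation.Binary.Construct.On as On
import Relation.Binary.Reasoning.Setoid as SetoidReasoning
open import Relation.Nullary using (yes; no; does; contradiction)
import Relation.Nullary.Decidable as Dec
open import Relation.Unary using (Pred; _⊆_) renaming (Decidable to Decidable₁)
open import Relation.Unary.Properties using (∁?)
open import Algebra.Bundles using (CommutativeRing)
import Algebra.Properties.Group as GroupProperties
import Algebra.Properties.AbelianGroup as AbelianGroupProperties
import Algebra.Properties.Ring as RingProperties

module IntegersInOrderedField (R : CompleteOrderedField) where

  open CompleteOrderedField R hiding (_∈_ℤ) renaming (_≤_ to _≤ᴿ_)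
  open IsTotalOrder isTotalOrder using (total; antisym) renaming (refl to ≤-refl; trans to ≤-trans)

  commutativeRing : CommutativeRing 0ℓ 0ℓ
  commutativeRing = record { isCommutativeRing = isCommutativeRing }

  open CommutativeRing commutativeRing public
    using (+-assoc; +-comm; +-identityˡ; +-identityʳ; -‿inverseʳ)
  open CommutativeRing commutativeRing using (+-group; +-abelianGroup; ring)
  open GroupProperties +-group using (ε⁻¹≈ε; ⁻¹-involutive; //-rightDividesˡ; //-rightDividesʳ)
  open AbelianGroupProperties +-abelianGroup using (⁻¹-anti-homo‿-; ⁻¹-∙-comm)
  open RingProperties ring using (-1*x≈-x)
  open ≡-Reasoning

  [u-v]+v≡u : ∀ u v → (u - v) + v ≡ u
  [u-v]+v≡u u v = //-rightDividesˡ v u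

  u≡w+v⇒u-v≡w : ∀ {u v w} → u ≡ w + v → u - v ≡ w
  u≡w+v⇒u-v≡w {v = v} {w} refl = //-rightDividesʳ v w

  -[u-v]≡v-u : ∀ u v → - (u - v) ≡ v - u
  -[u-v]≡v-u = ⁻¹-anti-homo‿-

  u+[v-u]≡v : ∀ u v → u + (v - u) ≡ v
  u+[v-u]≡v u v = trans (+-comm u (v - u)) ([u-v]+v≡u v u)

  [u-v]+[v-w]≡u-w : ∀ u v w → (u - v) + (v - w) ≡ u - w
  [u-v]+[v-w]≡u-w u v w = sym (u≡w+v⇒u-v≡w (begin
    u                        ≡⟨ [u-v]+v≡u u v ⟨
    (u - v) + v              ≡⟨ cong (λ z → (u - v) + z) ([u-v]+v≡u v w) ⟨
    (u - v) + ((v - w) + w)  ≡⟨ +-assoc (u - v) (v - w) w ⟨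
    (u - v) + (v - w) + w    ∎))

  [w+u]-[w+v]≡u-v : ∀ w u v → (w + u) - (w + v) ≡ u - v
  [w+u]-[w+v]≡u-v w u v = u≡w+v⇒u-v≡w (begin
    w + u              ≡⟨ +-comm w u ⟩
    u + w              ≡⟨ cong (_+ w) ([u-v]+v≡u u v) ⟨
    (u - v) + v + w    ≡⟨ +-assoc (u - v) v w ⟩
    (u - v) + (v + w)  ≡⟨ cong (λ z → (u - v) + z) (+-comm v w) ⟩
    (u - v) + (w + v)  ∎)

  fromℕ-+ : ∀ a b → fromℕ (a ℕ.+ b) ≡ fromℕ a + fromℕ b
  fromℕ-+ zero    b = sym (+-identityˡ (fromℕ b))
  fromℕ-+ (suc a) b = trans (cong (λ z → 1# + z) (fromℕ-+ a b)) (sym (+-assoc 1# (fromℕ a) (fromℕ b)))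

  fromℤ-⊖ : ∀ a b → fromℤ (a ⊖ b) ≡ fromℕ a - fromℕ b
  fromℤ-⊖ zero    zero    = sym (-‿inverseʳ 0#)
  fromℤ-⊖ zero    (suc b) = sym (+-identityˡ _)
  fromℤ-⊖ (suc a) zero    = sym (trans (cong (λ z → fromℕ (suc a) + z) ε⁻¹≈ε) (+-identityʳ _))
  fromℤ-⊖ (suc a) (suc b) = begin
    fromℤ (suc a ⊖ suc b)          ≡⟨ cong fromℤ ([1+m]⊖[1+n]≡m⊖n a b) ⟩
    fromℤ (a ⊖ b)                  ≡⟨ fromℤ-⊖ a b ⟩
    fromℕ a - fromℕ b              ≡⟨ [w+u]-[w+v]≡u-v 1# (fromℕ a) (fromℕ b) ⟨
    fromℕ (suc a) - fromℕ (suc b)  ∎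

  fromℤ-+ : ∀ i j → fromℤ (i ℤ.+ j) ≡ fromℤ i + fromℤ j
  fromℤ-+ (+ a)    (+ b)    = fromℕ-+ a b
  fromℤ-+ (+ a)    -[1+ b ] = fromℤ-⊖ a (suc b)
  fromℤ-+ -[1+ a ] (+ b)    = trans (fromℤ-⊖ b (suc a)) (+-comm _ _)
  fromℤ-+ -[1+ a ] -[1+ b ] = begin
    - fromℕ (suc (suc (a ℕ.+ b)))      ≡⟨ cong (λ k → - fromℕ (suc k)) (+-suc a b) ⟨
    - fromℕ (suc a ℕ.+ suc b)          ≡⟨ cong -_ (fromℕ-+ (suc a) (suc b)) ⟩
    - (fromℕ (suc a) + fromℕ (suc b))  ≡⟨ ⁻¹-∙-comm _ _ ⟨
    - fromℕ (suc a) + - fromℕ (suc b)  ∎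

  fromℤ-neg : ∀ i → fromℤ (ℤ.- i) ≡ - fromℤ i
  fromℤ-neg -[1+ a ]  = sym (⁻¹-involutive _)
  fromℤ-neg (+ zero)  = sym ε⁻¹≈ε
  fromℤ-neg (+ suc a) = refl

  fromℤ-minus : ∀ i j → fromℤ (i ℤ.- j) ≡ fromℤ i - fromℤ j
  fromℤ-minus i j = trans (fromℤ-+ i (ℤ.- j)) (cong (λ z → fromℤ i + z) (fromℤ-neg j))

  -- If 1 ≤ 0 then 0 ≤ -1, hence 0 ≤ (-1) * (-1) = 1.
  0≤1 : 0# ≤ᴿ 1#
  0≤1 with total 0# 1#
  ... | inj₁ 0≤1 = 0≤1
  ... | inj₂ 1≤0 = subst (0# ≤ᴿ_) [-1][-1]≡1 (*-nonneg 0≤-1 0≤-1)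
    where
    0≤-1 : 0# ≤ᴿ - 1#
    0≤-1 = subst₂ _≤ᴿ_ (-‿inverseʳ 1#) (+-identityˡ (- 1#)) (+-mono-≤ (- 1#) 1≤0)
    [-1][-1]≡1 : - 1# * - 1# ≡ 1#
    [-1][-1]≡1 = trans (-1*x≈-x (- 1#)) (⁻¹-involutive 1#)

  0≤fromℕ : ∀ a → 0# ≤ᴿ fromℕ a
  0≤fromℕ zero    = ≤-refl
  0≤fromℕ (suc a) = ≤-trans (0≤fromℕ a)
    (subst (_≤ᴿ 1# + fromℕ a) (+-identityˡ (fromℕ a)) (+-mono-≤ (fromℕ a) 0≤1))

  fromℕ[1+a]≢0 : ∀ a → fromℕ (suc a) ≢ 0#
  fromℕ[1+a]≢0 a eq = 0≢1 (antisym 0≤1 (subst (1# ≤ᴿ_) eq 1≤1+a))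
    where
    1≤1+a : 1# ≤ᴿ 1# + fromℕ a
    1≤1+a = subst₂ _≤ᴿ_ (+-identityˡ 1#) (+-comm (fromℕ a) 1#) (+-mono-≤ 1# (0≤fromℕ a))

  fromℤ≡0⇒≡0 : ∀ i → fromℤ i ≡ 0# → i ≡ 0ℤ
  fromℤ≡0⇒≡0 (+ zero)  _  = refl
  fromℤ≡0⇒≡0 (+ suc a) eq = ⊥-elim (fromℕ[1+a]≢0 a eq)
  fromℤ≡0⇒≡0 -[1+ a ]  eq = ⊥-elim (fromℕ[1+a]≢0 a (begin
    fromℕ (suc a)      ≡⟨ ⁻¹-involutive _ ⟨
    - - fromℕ (suc a)  ≡⟨ cong -_ eq ⟩
    - 0#               ≡⟨ ε⁻¹≈ε ⟩
    0#                 ∎))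

  fromℤ-injective : ∀ {i j} → fromℤ i ≡ fromℤ j → i ≡ j
  fromℤ-injective {i} {j} eq = i-j≡0⇒i≡j i j (fromℤ≡0⇒≡0 (i ℤ.- j) (begin
    fromℤ (i ℤ.- j)    ≡⟨ fromℤ-minus i j ⟩
    fromℤ i - fromℤ j  ≡⟨ cong (_- fromℤ j) eq ⟩
    fromℤ j - fromℤ j  ≡⟨ -‿inverseʳ (fromℤ j) ⟩
    0#                 ∎))

  u-0≡u : ∀ u → u - 0# ≡ u
  u-0≡u u = trans (cong (λ z → u + z) ε⁻¹≈ε) (+-identityʳ u)

module CongruenceModulo (R : CompleteOrderedField) where

  open CompleteOrderedField R hiding (_≤_)
  open IntegersInOrderedField R

  infix 4 _≡_[mod_]
  -- A record rather than a synonym for (u - v) ∈ k ℤ, so that k can be inferred.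
  record _≡_[mod_] (u v : Carrier) (k : ℕ) : Set where
    constructor mk≡[mod]
    field difference∈kℤ : (u - v) ∈ k ℤ

  open _≡_[mod_] public

  ≡[mod]-reflexive : ∀ {k u v} → u ≡ v → u ≡ v [mod k ]
  ≡[mod]-reflexive {k} {u} refl = mk≡[mod] (+ 0 , (begin
    u - u                ≡⟨ -‿inverseʳ u ⟩
    0#                   ≡⟨ cong fromℤ (ℤ.*-zeroʳ (+ k)) ⟨
    fromℤ (+ k ℤ.* + 0)  ∎))
    where open ≡-Reasoning

  ≡[mod]-sym : ∀ {k u v} → u ≡ v [mod k ] → v ≡ u [mod k ]
  ≡[mod]-sym {k} {u} {v} (mk≡[mod] (t , u-v≡kt)) = mk≡[mod] (ℤ.- t , (begin
    v - u                    ≡⟨ -[u-v]≡v-u u v ⟨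
    - (u - v)                ≡⟨ cong -_ u-v≡kt ⟩
    - fromℤ (+ k ℤ.* t)      ≡⟨ fromℤ-neg (+ k ℤ.* t) ⟨
    fromℤ (ℤ.- (+ k ℤ.* t))  ≡⟨ cong fromℤ (neg-distribʳ-* (+ k) t) ⟩
    fromℤ (+ k ℤ.* ℤ.- t)    ∎))
    where open ≡-Reasoning

  ≡[mod]-trans : ∀ {k u v w} → u ≡ v [mod k ] → v ≡ w [mod k ] → u ≡ w [mod k ]
  ≡[mod]-trans {k} {u} {v} {w} (mk≡[mod] (s , u-v≡ks)) (mk≡[mod] (t , v-w≡kt)) =
    mk≡[mod] (s ℤ.+ t , (begin
    u - w                                  ≡⟨ [u-v]+[v-w]≡u-w u v w ⟨
    (u - v) + (v - w)                      ≡⟨ cong₂ _+_ u-v≡ks v-w≡kt ⟩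
    fromℤ (+ k ℤ.* s) + fromℤ (+ k ℤ.* t)  ≡⟨ fromℤ-+ (+ k ℤ.* s) (+ k ℤ.* t) ⟨
    fromℤ (+ k ℤ.* s ℤ.+ + k ℤ.* t)        ≡⟨ cong fromℤ (ℤ.*-distribˡ-+ (+ k) s t) ⟨
    fromℤ (+ k ℤ.* (s ℤ.+ t))              ∎))
    where open ≡-Reasoning

  ≡[mod]-isEquivalence : ∀ k → IsEquivalence (λ u v → u ≡ v [mod k ])
  ≡[mod]-isEquivalence k = record
    { refl = ≡[mod]-reflexive refl ; sym = ≡[mod]-sym ; trans = ≡[mod]-trans }

  ≡[mod]-setoid : ℕ → Setoid 0ℓ 0ℓ
  ≡[mod]-setoid k = record { isEquivalence = ≡[mod]-isEquivalence k }

  module ≡[mod]-Reasoning (k : ℕ) = SetoidReasoning (≡[mod]-setoid k)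

  +-congʳ-≡[mod] : ∀ {k u v} w → u ≡ v [mod k ] → u + w ≡ v + w [mod k ]
  +-congʳ-≡[mod] {k} {u} {v} w (mk≡[mod] (t , u-v≡kt)) = mk≡[mod] (t , (begin
    (u + w) - (v + w)  ≡⟨ cong₂ _-_ (+-comm u w) (+-comm v w) ⟩
    (w + u) - (w + v)  ≡⟨ [w+u]-[w+v]≡u-v w u v ⟩
    u - v              ≡⟨ u-v≡kt ⟩
    fromℤ (+ k ℤ.* t)  ∎))
    where open ≡-Reasoning

  +-congˡ-≡[mod] : ∀ {k v w} u → v ≡ w [mod k ] → u + v ≡ u + w [mod k ]
  +-congˡ-≡[mod] {v = v} {w} u (mk≡[mod] (t , v-w≡kt)) =
    mk≡[mod] (t , trans ([w+u]-[w+v]≡u-v u v w) v-w≡kt)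

  +-cancelʳ-≡[mod] : ∀ {k u v} w → u + w ≡ v + w [mod k ] → u ≡ v [mod k ]
  +-cancelʳ-≡[mod] {k} {u} {v} w (mk≡[mod] (t , u+w-[v+w]≡kt)) = mk≡[mod] (t , (begin
    u - v              ≡⟨ [w+u]-[w+v]≡u-v w u v ⟨
    (w + u) - (w + v)  ≡⟨ cong₂ _-_ (+-comm w u) (+-comm w v) ⟩
    (u + w) - (v + w)  ≡⟨ u+w-[v+w]≡kt ⟩
    fromℤ (+ k ℤ.* t)  ∎))
    where open ≡-Reasoning

  ≡[mod]-∣ : ∀ {d k u v} → d ∣ k → u ≡ v [mod k ] → u ≡ v [mod d ]
  ≡[mod]-∣ {d} (divides c refl) (mk≡[mod] (t , u-v≡kt)) =
    mk≡[mod] (+ c ℤ.* t , trans u-v≡kt (cong fromℤ (begin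
    + (c ℕ.* d) ℤ.* t    ≡⟨ cong (ℤ._* t) (pos-* c d) ⟩
    + c ℤ.* + d ℤ.* t    ≡⟨ cong (ℤ._* t) (ℤ.*-comm (+ c) (+ d)) ⟩
    + d ℤ.* + c ℤ.* t    ≡⟨ ℤ.*-assoc (+ d) (+ c) t ⟩
    + d ℤ.* (+ c ℤ.* t)  ∎)))
    where open ≡-Reasoning

  fromℤ-≡[mod] : ∀ {k i j} → + k ∣ℤ i ℤ.- j → fromℤ i ≡ fromℤ j [mod k ]
  fromℤ-≡[mod] {k} {i} {j} (divides t i-j≡tk) = mk≡[mod] (t , (begin
    fromℤ i - fromℤ j  ≡⟨ fromℤ-minus i j ⟨
    fromℤ (i ℤ.- j)    ≡⟨ cong fromℤ (trans i-j≡tk (ℤ.*-comm t (+ k))) ⟩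
    fromℤ (+ k ℤ.* t)  ∎))
    where open ≡-Reasoning

  fromℕ≡0[mod]⇔∣ : ∀ {k a} → fromℕ a ≡ 0# [mod k ] ⇔ k ∣ a
  fromℕ≡0[mod]⇔∣ {k} {a} = mk⇔ to from
    where
    open ≡-Reasoning
    to : fromℕ a ≡ 0# [mod k ] → k ∣ a
    to (mk≡[mod] (t , a-0≡kt)) = divides ℤ.∣ t ∣ (begin
      a                ≡⟨ cong ℤ.∣_∣ (fromℤ-injective {+ a} {+ k ℤ.* t} a≡kt) ⟩
      ℤ.∣ + k ℤ.* t ∣  ≡⟨ abs-* (+ k) t ⟩
      k ℕ.* ℤ.∣ t ∣    ≡⟨ *-comm k ℤ.∣ t ∣ ⟩
      ℤ.∣ t ∣ ℕ.* k    ∎)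
      where
      a≡kt : fromℕ a ≡ fromℤ (+ k ℤ.* t)
      a≡kt = trans (sym (u-0≡u (fromℕ a))) a-0≡kt
    from : k ∣ a → fromℕ a ≡ 0# [mod k ]
    from (divides c a≡ck) = mk≡[mod] (+ c , (begin
      fromℕ a - 0#         ≡⟨ u-0≡u (fromℕ a) ⟩
      fromℤ (+ a)          ≡⟨ cong (fromℤ ∘ +_) (trans a≡ck (*-comm c k)) ⟩
      fromℤ (+ (k ℕ.* c))  ≡⟨ cong fromℤ (pos-* k c) ⟩
      fromℤ (+ k ℤ.* + c)  ∎))

  multiple+u≡u[mod] : ∀ {k a} u → k ∣ a → fromℕ a + u ≡ u [mod k ]
  multiple+u≡u[mod] u k∣a = ≡[mod]-trans
    (+-congʳ-≡[mod] u (Equivalence.from fromℕ≡0[mod]⇔∣ k∣a))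
    (≡[mod]-reflexive (+-identityˡ u))

module WordDrift (R : CompleteOrderedField) {m : ℕ} where

  open CompleteOrderedField R hiding (_≤_; _∈_ℤ)
  open IntegersInOrderedField R
  open CongruenceModulo R

  shift-drift : ∀ (i : Fin m) x l → x l ≡ 1# + shift i x l [mod m ]
  shift-drift i x l with i Fin.≟ l
  ... | yes _ = begin
    x l                              ≈⟨ multiple+u≡u[mod] (x l) (∣-refl {m}) ⟨
    fromℕ m + x l                    ≡⟨ +-comm (fromℕ m) (x l) ⟩
    x l + fromℕ m                    ≡⟨ u+[v-u]≡v 1# (x l + fromℕ m) ⟨
    1# + (x l + fromℕ m - 1#)        ∎
    where open ≡[mod]-Reasoning m
  ... | no  _ = ≡[mod]-reflexive (sym (u+[v-u]≡v 1# (x l)))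

  listAct-drift : ∀ w {x y : Fin m → Carrier} → ListAct w x y →
                  ∃ λ (ρ : Fin m → Fin m) → ∀ a → x (ρ a) ≡ fromℕ (length w) + y a [mod m ]
  listAct-drift []      x≗y = id , λ a → ≡[mod]-reflexive (trans (x≗y a) (sym (+-identityˡ _)))
  listAct-drift (i ∷ w) {x} {y} (z , (_ , π , z≗shift) , z→y) with listAct-drift w z→y
  ... | ρ , drift = (λ a → π ⟨$⟩ʳ ρ a) , λ a → begin
    x (π ⟨$⟩ʳ ρ a)                        ≈⟨ shift-drift i x (π ⟨$⟩ʳ ρ a) ⟩
    1# + shift i x (π ⟨$⟩ʳ ρ a)           ≡⟨ cong (λ u → 1# + u) (z≗shift (ρ a)) ⟨
    1# + z (ρ a)                          ≈⟨ +-congˡ-≡[mod] 1# (drift a) ⟩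
    1# + (fromℕ (length w) + y a)         ≡⟨ +-assoc 1# (fromℕ (length w)) (y a) ⟨
    fromℕ (suc (length w)) + y a          ∎
    where open ≡[mod]-Reasoning m

  fixedPoint-drift : ∀ {n} {p : Vec (Fin m) n} {x} → FixedPoint p x →
                     ∃ λ (ρ : Fin m → Fin m) → ∀ a → x (ρ a) ≡ fromℕ n + x a [mod m ]
  fixedPoint-drift {p = p} fixed with listAct-drift (Vec.toList p) fixed
  ... | ρ , drift rewrite length-toList p = ρ , drift

  alcoveInterior⇒separated : ∀ {x} → InAlcoveInterior m x → ∀ {a b} → x a ≡ x b [mod m ] → a ≡ b
  alcoveInterior⇒separated alcove {a} {b} xa≡xb with <-cmp a b
  ... | tri< a<b _ _ = ⊥-elim (alcove a b a<b (difference∈kℤ xa≡xb))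
  ... | tri≈ _ a≡b _ = a≡b
  ... | tri> _ _ b<a = ⊥-elim (alcove b a b<a (difference∈kℤ (≡[mod]-sym xa≡xb)))

module MultiplesModulo (m n : ℕ) .{{_ : NonZero m}} where

  open import Data.Nat.Base using (_+_; _*_)

  d : ℕ
  d = gcd m n

  instance
    d≢0 : NonZero d
    d≢0 = ≢-nonZero (gcd[m,n]≢0 m n (inj₁ (≢-nonZero⁻¹ m)))

  q : ℕ
  q = m / d

  instance
    q≢0 : NonZero q
    q≢0 = ≢-nonZero (m/gcd[m,n]≢0 m n)

  n′ : ℕ
  n′ = n / d

  m≡q*d : m ≡ q * d
  m≡q*d = sym (m/n*n≡m (gcd[m,n]∣m m n))

  n≡n′*d : n ≡ n′ * d
  n≡n′*d = sym (m/n*n≡m (gcd[m,n]∣n m n))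

  m∣k*n⇒q∣k : ∀ {k} → m ∣ k * n → q ∣ k
  m∣k*n⇒q∣k {k} m∣kn = coprime-divisor (coprime-/gcd m n) (subst (q ∣_) (*-comm k n′) q∣kn′)
    where
    q∣kn′ : q ∣ k * n′
    q∣kn′ = *-cancelʳ-∣ d (subst₂ _∣_ m≡q*d kn≡kn′d m∣kn)
      where
      kn≡kn′d : k * n ≡ k * n′ * d
      kn≡kn′d = trans (cong (k *_) n≡n′*d) (sym (*-assoc k n′ d))

  m∣q*n : m ∣ q * n
  m∣q*n = divides n′ (begin
    q * n         ≡⟨ cong (q *_) n≡n′*d ⟩
    q * (n′ * d)  ≡⟨ cong (q *_) (*-comm n′ d) ⟩
    q * (d * n′)  ≡⟨ *-assoc q d n′ ⟨
    q * d * n′    ≡⟨ cong (_* n′) m≡q*d ⟨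
    m * n′        ≡⟨ *-comm m n′ ⟩
    n′ * m        ∎)
    where open ≡-Reasoning

  pos-+* : ∀ a b c → + (a + b * c) ≡ + a ℤ.+ + b ℤ.* + c
  pos-+* a b c = trans (pos-+ a (b * c)) (cong (λ z → + a ℤ.+ z) (pos-* b c))

  d≡Wn[mod-m] : ∃ λ (W : ℤ) → + m ∣ℤ W ℤ.* + n ℤ.- + d
  d≡Wn[mod-m] with Bézout.identity (gcd-GCD m n)
  ... | Bézout.+- a b d+bn≡am = ℤ.- + b , divides (ℤ.- + a) (begin
    ℤ.- + b ℤ.* + n ℤ.- + d      ≡⟨ negate (+ b) (+ n) (+ d) ⟩
    ℤ.- (+ d ℤ.+ + b ℤ.* + n)    ≡⟨ cong ℤ.-_ (pos-+* d b n) ⟨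
    ℤ.- + (d + b * n)            ≡⟨ cong (ℤ.-_ ∘ +_) d+bn≡am ⟩
    ℤ.- + (a * m)                ≡⟨ cong ℤ.-_ (pos-* a m) ⟩
    ℤ.- (+ a ℤ.* + m)            ≡⟨ ℤ.neg-distribˡ-* (+ a) (+ m) ⟩
    ℤ.- + a ℤ.* + m              ∎)
    where
    open ≡-Reasoning
    negate : ∀ B N D → ℤ.- B ℤ.* N ℤ.- D ≡ ℤ.- (D ℤ.+ B ℤ.* N)
    negate = solve-∀
  ... | Bézout.-+ a b d+am≡bn = + b , divides (+ a) (begin
    + b ℤ.* + n ℤ.- + d          ≡⟨ cong (ℤ._- + d) (pos-* b n) ⟨
    + (b * n) ℤ.- + d            ≡⟨ cong (λ z → + z ℤ.- + d) d+am≡bn ⟨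
    + (d + a * m) ℤ.- + d        ≡⟨ cong (ℤ._- + d) (pos-+* d a m) ⟩
    + d ℤ.+ + a ℤ.* + m ℤ.- + d  ≡⟨ cancel (+ d) (+ a ℤ.* + m) ⟩
    + a ℤ.* + m                  ∎)
    where
    open ≡-Reasoning
    cancel : ∀ D X → D ℤ.+ X ℤ.- D ≡ X
    cancel = solve-∀

  -- With W n ≡ d (mod m), the witness is j ≡ W t (mod q), as m ∣ q n.
  jn≡dt[mod-m] : ∀ t → ∃ λ (j : Fin q) → + m ∣ℤ + (toℕ j * n) ℤ.- + d ℤ.* t
  jn≡dt[mod-m] t with d≡Wn[mod-m]
  ... | W , m∣Wn-d =
    j , subst (+ m ∣ℤ_) (sym jn-dt≡) (ℤ∣.∣m∣n⇒∣m-n (ℤ∣.∣n⇒∣m*n t m∣Wn-d) (ℤ∣.∣n⇒∣m*n Y m∣qn))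
    where
    open ≡-Reasoning
    J = W ℤ.* t
    Y = J /ℕ q
    j : Fin q
    j = fromℕ< (n%ℕd<d J q)
    m∣qn : + m ∣ℤ + q ℤ.* + n
    m∣qn = subst (+ m ∣ℤ_) (pos-* q n) (∣ᵤ⇒∣ m∣q*n)
    expand : ∀ r Y Q N D t →
             r ℤ.* N ℤ.- D ℤ.* t ≡ (r ℤ.+ Y ℤ.* Q) ℤ.* N ℤ.- D ℤ.* t ℤ.- Y ℤ.* (Q ℤ.* N)
    expand = solve-∀
    collect : ∀ W t N D Y QN →
              W ℤ.* t ℤ.* N ℤ.- D ℤ.* t ℤ.- Y ℤ.* QN ≡ t ℤ.* (W ℤ.* N ℤ.- D) ℤ.- Y ℤ.* QN
    collect = solve-∀
    jn-dt≡ : + (toℕ j * n) ℤ.- + d ℤ.* t ≡ t ℤ.* (W ℤ.* + n ℤ.- + d) ℤ.- Y ℤ.* (+ q ℤ.* + n)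
    jn-dt≡ = begin
      + (toℕ j * n) ℤ.- + d ℤ.* t
        ≡⟨ cong (λ z → + (z * n) ℤ.- + d ℤ.* t) (toℕ-fromℕ< (n%ℕd<d J q)) ⟩
      + ((J %ℕ q) * n) ℤ.- + d ℤ.* t
        ≡⟨ cong (ℤ._- + d ℤ.* t) (pos-* (J %ℕ q) n) ⟩
      + (J %ℕ q) ℤ.* + n ℤ.- + d ℤ.* t
        ≡⟨ expand (+ (J %ℕ q)) Y (+ q) (+ n) (+ d) t ⟩
      (+ (J %ℕ q) ℤ.+ Y ℤ.* + q) ℤ.* + n ℤ.- + d ℤ.* t ℤ.- Y ℤ.* (+ q ℤ.* + n)
        ≡⟨ cong (λ z → z ℤ.* + n ℤ.- + d ℤ.* t ℤ.- Y ℤ.* (+ q ℤ.* + n)) (a≡a%ℕn+[a/ℕn]*n J q) ⟨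
      J ℤ.* + n ℤ.- + d ℤ.* t ℤ.- Y ℤ.* (+ q ℤ.* + n)
        ≡⟨ collect W t (+ n) (+ d) Y (+ q ℤ.* + n) ⟩
      t ℤ.* (W ℤ.* + n ℤ.- + d) ℤ.- Y ℤ.* (+ q ℤ.* + n)  ∎

module _ {A : Set} where

  open Membership using (_∈_)

  length-filter-∁ : ∀ {P : Pred A 0ℓ} (P? : Decidable₁ P) xs →
                    length (filter P? xs) ℕ.+ length (filter (∁? P?) xs) ≡ length xs
  length-filter-∁ P? []       = refl
  length-filter-∁ P? (x ∷ xs) with does (P? x)
  ... | true  = cong suc (length-filter-∁ P? xs)
  ... | false = trans (+-suc _ _) (cong suc (length-filter-∁ P? xs))

  filter-filter-⊆ : ∀ {P Q : Pred A 0ℓ} (P? : Decidable₁ P) (Q? : Decidable₁ Q) → P ⊆ Q →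
                    ∀ xs → filter P? (filter Q? xs) ≡ filter P? xs
  filter-filter-⊆ P? Q? P⊆Q []       = refl
  filter-filter-⊆ P? Q? P⊆Q (x ∷ xs) with Q? x
  ... | yes _ with P? x
  ...   | yes _ = cong (x ∷_) (filter-filter-⊆ P? Q? P⊆Q xs)
  ...   | no  _ = filter-filter-⊆ P? Q? P⊆Q xs
  filter-filter-⊆ P? Q? P⊆Q (x ∷ xs) | no ¬qx with P? x
  ...   | yes px = contradiction (P⊆Q px) ¬qx
  ...   | no  _  = filter-filter-⊆ P? Q? P⊆Q xs

  unique∧set⇒length≡ : ∀ {xs ys : List A} → Unique xs → Unique ys →
                       (∀ {z} → z ∈ xs ⇔ z ∈ ys) → length xs ≡ length ys
  unique∧set⇒length≡ xs! ys! xs⇔ys = ↭-length (∼bag⇒↭ (unique∧set⇒bag xs! ys! xs⇔ys))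

count-tabulate : ∀ {A : Set} {P : Pred A 0ℓ} (P? : Decidable₁ P) {k} (f : Fin k → A) →
                 Vec.count P? (Vec.tabulate f) ≡ length (filter P? (List.tabulate f))
count-tabulate P? {zero}  f = refl
count-tabulate P? {suc k} f with does (P? (f Fin.zero))
... | true  = cong suc (count-tabulate P? (f ∘ Fin.suc))
... | false = count-tabulate P? (f ∘ Fin.suc)

module Equipartition {A : Set} {_∼_ : Rel A 0ℓ} (∼-isEquivalence : IsEquivalence _∼_)
  (_∼?_ : Decidable _∼_) (q : ℕ) .{{_ : NonZero q}} where

  open Membership using (_∈_)
  open IsEquivalence ∼-isEquivalence renaming (refl to ∼-refl; sym to ∼-sym; trans to ∼-trans)

  class : A → List A → List A
  class a = filter (a ∼?_)

  record Colouring (k : ℕ) (L : List A) : Set where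
    field
      colour      : A → ℕ
      colour<k    : ∀ {a} → a ∈ L → colour a < k
      colour-onto : ∀ {i} → i < k → ∃ λ a → a ∈ L × colour a ≡ i
      colour≡⇔∼   : ∀ {a b} → a ∈ L → b ∈ L → colour a ≡ colour b ⇔ a ∼ b

  colouring : ∀ k L → length L ≡ k ℕ.* q → (∀ {a} → a ∈ L → length (class a L) ≡ q) →
              Colouring k L
  colouring zero    []      _   _ = record
    { colour = λ _ → 0 ; colour<k = λ () ; colour-onto = λ () ; colour≡⇔∼ = λ () }
  colouring (suc k) []      len _ = contradiction (m+n≡0⇒m≡0 q (sym len)) (≢-nonZero⁻¹ q)
  colouring (suc k) L@(s ∷ _) len sizes = record
    { colour = colour ; colour<k = colour<k ; colour-onto = colour-onto ; colour≡⇔∼ = colour≡⇔∼ }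
    where
    open ≡-Reasoning

    rest : List A
    rest = filter (∁? (s ∼?_)) L

    rest⁺ : ∀ {a} → a ∈ L → ¬ s ∼ a → a ∈ rest
    rest⁺ = ∈-filter⁺ (∁? (s ∼?_))

    class-rest : ∀ {a} → ¬ s ∼ a → class a rest ≡ class a L
    class-rest ¬s∼a =
      filter-filter-⊆ (_ ∼?_) (∁? (s ∼?_)) (λ a∼b s∼b → ¬s∼a (∼-trans s∼b (∼-sym a∼b))) L

    length-rest : length rest ≡ k ℕ.* q
    length-rest = +-cancelˡ-≡ q _ _ (begin
      q ℕ.+ length rest                   ≡⟨ cong (ℕ._+ length rest) (sizes (here refl)) ⟨
      length (class s L) ℕ.+ length rest  ≡⟨ length-filter-∁ (s ∼?_) L ⟩
      length L                            ≡⟨ len ⟩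
      suc k ℕ.* q                         ∎)

    rest-sizes : ∀ {a} → a ∈ rest → length (class a rest) ≡ q
    rest-sizes a∈rest =
      let a∈L , ¬s∼a = ∈-filter⁻ (∁? (s ∼?_)) a∈rest
      in  trans (cong length (class-rest ¬s∼a)) (sizes a∈L)

    module Rest = Colouring (colouring k rest length-rest rest-sizes)

    colour : A → ℕ
    colour a with s ∼? a
    ... | yes _ = k
    ... | no  _ = Rest.colour a

    colour-class : ∀ {a} → s ∼ a → colour a ≡ k
    colour-class {a} s∼a with s ∼? a
    ... | yes _    = refl
    ... | no ¬s∼a  = contradiction s∼a ¬s∼a

    colour-rest : ∀ {a} → ¬ s ∼ a → colour a ≡ Rest.colour a
    colour-rest {a} ¬s∼a with s ∼? a
    ... | yes s∼a = contradiction s∼a ¬s∼a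
    ... | no  _   = refl

    colour<k : ∀ {a} → a ∈ L → colour a < suc k
    colour<k {a} a∈L with s ∼? a
    ... | yes _    = n<1+n k
    ... | no ¬s∼a  = m<n⇒m<1+n (Rest.colour<k (rest⁺ a∈L ¬s∼a))

    colour-onto : ∀ {i} → i < suc k → ∃ λ a → a ∈ L × colour a ≡ i
    colour-onto i<1+k with m<1+n⇒m<n∨m≡n i<1+k
    ... | inj₂ refl = s , here refl , colour-class ∼-refl
    ... | inj₁ i<k  = let a , a∈rest , colour≡i = Rest.colour-onto i<k
                          a∈L , ¬s∼a = ∈-filter⁻ (∁? (s ∼?_)) a∈rest
                      in a , a∈L , trans (colour-rest ¬s∼a) colour≡i

    colour≡⇔∼ : ∀ {a b} → a ∈ L → b ∈ L → colour a ≡ colour b ⇔ a ∼ b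
    colour≡⇔∼ {a} {b} a∈L b∈L with s ∼? a | s ∼? b
    ... | yes s∼a | yes s∼b = mk⇔ (λ _ → ∼-trans (∼-sym s∼a) s∼b) (λ _ → refl)
    ... | yes s∼a | no ¬s∼b = mk⇔
      (λ k≡colour-b → contradiction (sym k≡colour-b) (<⇒≢ (Rest.colour<k (rest⁺ b∈L ¬s∼b))))
      (λ a∼b → contradiction (∼-trans s∼a a∼b) ¬s∼b)
    ... | no ¬s∼a | yes s∼b = mk⇔
      (λ colour-a≡k → contradiction colour-a≡k (<⇒≢ (Rest.colour<k (rest⁺ a∈L ¬s∼a))))
      (λ a∼b → contradiction (∼-trans s∼b (∼-sym a∼b)) ¬s∼a)
    ... | no ¬s∼a | no ¬s∼b = Rest.colour≡⇔∼ (rest⁺ a∈L ¬s∼a) (rest⁺ b∈L ¬s∼b)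

module FinEquipartition {m : ℕ} {_∼_ : Rel (Fin m) 0ℓ} (∼-isEquivalence : IsEquivalence _∼_)
  (_∼?_ : Decidable _∼_) (q : ℕ) .{{_ : NonZero q}} where

  open Equipartition ∼-isEquivalence _∼?_ q

  equipartition : ∀ k → m ≡ k ℕ.* q → (∀ a → length (class a (List.allFin m)) ≡ q) →
                  Σ (Fin m → Fin k) λ c →
                    (∀ {a b} → c a ≡ c b ⇔ a ∼ b) × (∀ i → classSize c i ≡ q)
  equipartition k m≡kq sizes = c , c≡⇔∼ , classSize≡q
    where
    allFin-colouring : Colouring k (List.allFin m)
    allFin-colouring = colouring k (List.allFin m) (trans (length-tabulate id) m≡kq) (λ {a} _ → sizes a)

    open Colouring allFin-colouring

    c : Fin m → Fin k
    c a = fromℕ< (colour<k (∈-allFin a))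

    toℕ-c : ∀ a → toℕ (c a) ≡ colour a
    toℕ-c a = toℕ-fromℕ< (colour<k (∈-allFin a))

    c≡⇔colour≡ : ∀ {a b} → c a ≡ c b ⇔ colour a ≡ colour b
    c≡⇔colour≡ {a} {b} = mk⇔
      (λ ca≡cb → trans (sym (toℕ-c a)) (trans (cong toℕ ca≡cb) (toℕ-c b)))
      (λ colour≡ → toℕ-injective (trans (toℕ-c a) (trans colour≡ (sym (toℕ-c b)))))

    c≡⇔∼ : ∀ {a b} → c a ≡ c b ⇔ a ∼ b
    c≡⇔∼ {a} {b} = ⇔-trans c≡⇔colour≡ (colour≡⇔∼ (∈-allFin a) (∈-allFin b))

    classSize≡q : ∀ i → classSize c i ≡ q
    classSize≡q i with colour-onto (toℕ<n i)
    ... | a , _ , colour-a≡i = begin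
      classSize c i
        ≡⟨ count-tabulate (λ b → c b Fin.≟ i) id ⟩
      length (filter (λ b → c b Fin.≟ i) (List.allFin m))
        ≡⟨ cong length (filter-≐ _ _ (c≡i⇒a∼ , a∼⇒c≡i) (List.allFin m)) ⟩
      length (class a (List.allFin m))
        ≡⟨ sizes a ⟩
      q ∎
      where
      open ≡-Reasoning
      ca≡i : c a ≡ i
      ca≡i = toℕ-injective (trans (toℕ-c a) colour-a≡i)
      c≡i⇒a∼ : ∀ {b} → c b ≡ i → a ∼ b
      c≡i⇒a∼ cb≡i = Equivalence.to c≡⇔∼ (trans ca≡i (sym cb≡i))
      a∼⇒c≡i : ∀ {b} → a ∼ b → c b ≡ i
      a∼⇒c≡i a∼b = trans (sym (Equivalence.from c≡⇔∼ a∼b)) ca≡i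

module _ (R : CompleteOrderedField) where

  open CompleteOrderedField R hiding (_≤_; _∈_ℤ)
  open IntegersInOrderedField R
  open CongruenceModulo R

  module FixedPointOrbits (m n : ℕ) .{{_ : NonZero m}} (x : Fin m → Carrier) (ρ : Fin m → Fin m)
    (drift : ∀ a → x (ρ a) ≡ fromℕ n + x a [mod m ])
    (separated : ∀ {a b} → x a ≡ x b [mod m ] → a ≡ b) where

    open MultiplesModulo m n
    open Membership using (_∈_)
    open import Function.Endo.Propositional (Fin m) using (_^_; ^-homo)

    _∼_ : Rel (Fin m) 0ℓ
    a ∼ b = x a ≡ x b [mod d ]

    ∼-isEquivalence : IsEquivalence _∼_
    ∼-isEquivalence = On.isEquivalence x (≡[mod]-isEquivalence d)

    x-iterate : ∀ j a → x ((ρ ^ j) a) ≡ fromℕ (j ℕ.* n) + x a [mod m ]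
    x-iterate zero    a = ≡[mod]-reflexive (sym (+-identityˡ (x a)))
    x-iterate (suc j) a = begin
      x (ρ ((ρ ^ j) a))                      ≈⟨ drift ((ρ ^ j) a) ⟩
      fromℕ n + x ((ρ ^ j) a)                ≈⟨ +-congˡ-≡[mod] (fromℕ n) (x-iterate j a) ⟩
      fromℕ n + (fromℕ (j ℕ.* n) + x a)      ≡⟨ +-assoc (fromℕ n) (fromℕ (j ℕ.* n)) (x a) ⟨
      (fromℕ n + fromℕ (j ℕ.* n)) + x a      ≡⟨ cong (_+ x a) (fromℕ-+ n (j ℕ.* n)) ⟨
      fromℕ (suc j ℕ.* n) + x a              ∎
      where open ≡[mod]-Reasoning m

    ∼-iterate : ∀ j a → a ∼ (ρ ^ j) a
    ∼-iterate j a = ≡[mod]-sym (begin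
      x ((ρ ^ j) a)          ≈⟨ ≡[mod]-∣ (gcd[m,n]∣m m n) (x-iterate j a) ⟩
      fromℕ (j ℕ.* n) + x a  ≈⟨ multiple+u≡u[mod] (x a) (∣n⇒∣m*n j (gcd[m,n]∣n m n)) ⟩
      x a                    ∎)
      where open ≡[mod]-Reasoning d

    ∼⇒iterate : ∀ {a b} → a ∼ b → ∃ λ (j : Fin q) → (ρ ^ toℕ j) a ≡ b
    ∼⇒iterate {a} {b} a∼b = j , separated (begin
      x ((ρ ^ toℕ j) a)          ≈⟨ x-iterate (toℕ j) a ⟩
      fromℕ (toℕ j ℕ.* n) + x a  ≈⟨ +-congʳ-≡[mod] (x a) jn≡dt ⟩
      fromℤ (+ d ℤ.* t) + x a    ≡⟨ cong (_+ x a) xb-xa≡dt ⟨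
      (x b - x a) + x a          ≡⟨ [u-v]+v≡u (x b) (x a) ⟩
      x b                        ∎)
      where
      open ≡[mod]-Reasoning m
      t : ℤ
      t = proj₁ (difference∈kℤ (≡[mod]-sym a∼b))
      xb-xa≡dt : x b - x a ≡ fromℤ (+ d ℤ.* t)
      xb-xa≡dt = proj₂ (difference∈kℤ (≡[mod]-sym a∼b))
      j : Fin q
      j = proj₁ (jn≡dt[mod-m] t)
      jn≡dt : fromℕ (toℕ j ℕ.* n) ≡ fromℤ (+ d ℤ.* t) [mod m ]
      jn≡dt = fromℤ-≡[mod] {i = + (toℕ j ℕ.* n)} {j = + d ℤ.* t} (proj₂ (jn≡dt[mod-m] t))

    iterate-fixed⇒q∣ : ∀ j {a} → (ρ ^ j) a ≡ a → q ∣ j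
    iterate-fixed⇒q∣ j {a} fixed =
      m∣k*n⇒q∣k (Equivalence.to fromℕ≡0[mod]⇔∣ (+-cancelʳ-≡[mod] (x a) (begin
        fromℕ (j ℕ.* n) + x a  ≈⟨ x-iterate j a ⟨
        x ((ρ ^ j) a)          ≡⟨ cong x fixed ⟩
        x a                    ≡⟨ +-identityˡ (x a) ⟨
        0# + x a               ∎)))
      where open ≡[mod]-Reasoning m

    iterate-distinct : ∀ a {i j : Fin q} → i Fin.< j → (ρ ^ toℕ i) a ≢ (ρ ^ toℕ j) a
    iterate-distinct a {i} {j} i<j ρⁱa≡ρʲa =
      <⇒≱ k<q (∣⇒≤ {{>-nonZero (m<n⇒0<n∸m i<j)}} (iterate-fixed⇒q∣ k ρᵏρⁱa≡ρⁱa))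
      where
      open ≡-Reasoning
      k = toℕ j ∸ toℕ i
      k<q : k < q
      k<q = ≤-<-trans (m∸n≤m (toℕ j) (toℕ i)) (toℕ<n j)
      ρᵏρⁱa≡ρⁱa : (ρ ^ k) ((ρ ^ toℕ i) a) ≡ (ρ ^ toℕ i) a
      ρᵏρⁱa≡ρⁱa = begin
        (ρ ^ k) ((ρ ^ toℕ i) a)  ≡⟨ cong-app (^-homo ρ k (toℕ i)) a ⟨
        (ρ ^ (k ℕ.+ toℕ i)) a    ≡⟨ cong (λ l → (ρ ^ l) a) (m∸n+n≡m (<⇒≤ i<j)) ⟩
        (ρ ^ toℕ j) a            ≡⟨ ρⁱa≡ρʲa ⟨
        (ρ ^ toℕ i) a            ∎

    iterate-injective : ∀ a {i j : Fin q} → (ρ ^ toℕ i) a ≡ (ρ ^ toℕ j) a → i ≡ j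
    iterate-injective a {i} {j} ρⁱa≡ρʲa with <-cmp i j
    ... | tri< i<j _ _ = contradiction ρⁱa≡ρʲa (iterate-distinct a i<j)
    ... | tri≈ _ i≡j _ = i≡j
    ... | tri> _ _ j<i = contradiction (sym ρⁱa≡ρʲa) (iterate-distinct a j<i)

    -- Kept abstract: unification would otherwise unfold the search over Fin (m / gcd m n).
    abstract
      _∼?_ : Decidable _∼_
      a ∼? b = Dec.map′ (λ (j , ρʲa≡b) → subst (a ∼_) ρʲa≡b (∼-iterate (toℕ j) a)) ∼⇒iterate
                        (any? λ j → (ρ ^ toℕ j) a Fin.≟ b)

    ρ^ : Fin m → Fin q → Fin m
    ρ^ a j = (ρ ^ toℕ j) a

    orbit : Fin m → List (Fin m)
    orbit a = List.tabulate (ρ^ a)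

    ∈-class⇔∼ : ∀ {a b} → b ∈ filter (a ∼?_) (List.allFin m) ⇔ a ∼ b
    ∈-class⇔∼ {a} {b} = mk⇔
      (λ b∈class → proj₂ (∈-filter⁻ (a ∼?_) {xs = List.allFin m} b∈class))
      (∈-filter⁺ (a ∼?_) {xs = List.allFin m} (∈-allFin b))

    ∈-orbit⇔∼ : ∀ {a b} → b ∈ orbit a ⇔ a ∼ b
    ∈-orbit⇔∼ {a} = mk⇔
      (λ b∈orbit → let j , b≡ρʲa = ∈-tabulate⁻ {f = ρ^ a} b∈orbit
                   in subst (a ∼_) (sym b≡ρʲa) (∼-iterate (toℕ j) a))
      (λ a∼b → let j , ρʲa≡b = ∼⇒iterate a∼b
               in subst (_∈ orbit a) ρʲa≡b (∈-tabulate⁺ {f = ρ^ a} j))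

    class-size : ∀ a → length (filter (a ∼?_) (List.allFin m)) ≡ q
    class-size a = trans
      (unique∧set⇒length≡ (filter⁺ (a ∼?_) (allFin⁺ m)) (tabulate⁺ (iterate-injective a))
                          (⇔-trans ∈-class⇔∼ (⇔-sym ∈-orbit⇔∼)))
      (length-tabulate (ρ^ a))

    orbit-colouring : Σ (Fin m → Fin d) λ c →
                        (∀ {a b} → c a ≡ c b ⇔ a ∼ b) × (∀ i → classSize c i ℕ.* d ≡ m)
    orbit-colouring =
      let c , c≡⇔∼ , classSize≡q = equipartition d (trans m≡q*d (*-comm q d)) class-size
      in  c , c≡⇔∼ , λ i → trans (cong (ℕ._* d) (classSize≡q i)) (sym m≡q*d)
      where open FinEquipartition ∼-isEquivalence _∼?_ q

mainTheorem12 : (m n : ℕ) → 1 ≤ m → 1 ≤ n →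
    (R : CompleteOrderedField) → let open CompleteOrderedField R in
    (p : Vec (Fin m) n) → IsParking m n p →
    (x : Fin m → Carrier) → InV m x → FixedPoint p x → InAlcoveInterior m x →
    Σ (Fin m → Fin (gcd m n)) λ c →
      (∀ i → classSize c i ℕ.* gcd m n ≡ m) ×
      (∀ a b → a ≢ b → c a ≡ c b →
         ((x a - x b) ∈ gcd m n ℤ) × ¬ ((x a - x b) ∈ m ℤ)) ×
      (∀ a b → c a ≢ c b → ¬ ((x a - x b) ∈ gcd m n ℤ))
mainTheorem12 m n 1≤m _ R p _ x _ fixed alcove with WordDrift.fixedPoint-drift R fixed
... | ρ , drift = c , classSize≡ , same-class , different-classes
  where
  open CompleteOrderedField R hiding (_≤_)
  open CongruenceModulo R

  instance
    m≢0 : NonZero m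
    m≢0 = >-nonZero 1≤m

  separated : ∀ {a b} → x a ≡ x b [mod m ] → a ≡ b
  separated = WordDrift.alcoveInterior⇒separated R alcove

  open FixedPointOrbits R m n x ρ drift separated

  c : Fin m → Fin (gcd m n)
  c = proj₁ orbit-colouring

  c≡⇔∼ : ∀ {a b} → c a ≡ c b ⇔ a ∼ b
  c≡⇔∼ = proj₁ (proj₂ orbit-colouring)

  classSize≡ : ∀ i → classSize c i ℕ.* gcd m n ≡ m
  classSize≡ = proj₂ (proj₂ orbit-colouring)

  same-class : ∀ a b → a ≢ b → c a ≡ c b → ((x a - x b) ∈ gcd m n ℤ) × ¬ ((x a - x b) ∈ m ℤ)
  same-class a b a≢b ca≡cb =
    difference∈kℤ (Equivalence.to c≡⇔∼ ca≡cb) , a≢b ∘ separated ∘ mk≡[mod]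

  different-classes : ∀ a b → c a ≢ c b → ¬ ((x a - x b) ∈ gcd m n ℤ)
  different-classes a b ca≢cb = ca≢cb ∘ Equivalence.from c≡⇔∼ ∘ mk≡[mod]
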